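{- Let $A$ and $B$ be lattices, let $f\colon A\to B$ and $\pi_0,\pi_1\colon B\to A$ be lattice homomorphisms such that $\pi_0\circ f=\pi_1\circ f=\mathrm{id}_A$, and assume that $\operatorname{Con}_c B\cong\mathbf{2}^2$ with coatoms $\ker\pi_0$ and $\ker\pi_1$. Then there exist $u<v$ in $A$ and a congruence chain of $B$ with extremities $f(u)$ and $f(v)$.
   Context: $\operatorname{Con}_c B$ is the lattice of compact congruences of $B$; $\mathbf{2}^2$ is the four-element Boolean lattice; $\Theta_B(x,y)$ is the least congruence identifying $x,y$. For a lattice $B$ with $\operatorname{Con}_c B$ a finite Boolean lattice, a congruence chain of $B$ is a chain $x_0<x_1<\dots<x_n$ in $B$ for which there is a bijection $\sigma$ from $\{0,\dots,n-1\}$ onto the set of atoms of $\operatorname{Con}_c B$ with $\Theta_B(x_k,x_{k+1})=\sigma(k)$ for all $k<n$; its extremities are $x_0$ and $x_n$. -}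

module Defs where

open import Level using (Level; _⊔_)
open import Data.Nat using (ℕ; suc)
open import Data.Fin using (Fin; zero; suc; inject₁; fromℕ)
open import Data.Bool using (Bool; true; false)
import Data.Bool as Bool
open import Data.Product using (Σ; ∃; _×_; _,_; proj₁; proj₂)
open import Data.Sum using (_⊎_)
open import Data.List using (List; []; _∷_; [_])
open import Data.List.Membership.Propositional using (_∈_)
open import Relation.Nullary using (¬_)
open import Relation.Binary.Core using (Rel; _⇒_)
open import Relation.Binary.PropositionalEquality using (_≡_)
open import Algebra.Lattice.Bundles using (Lattice)
open import Algebra.Lattice.Morphism.Structures using (module LatticeMorphisms)

private variable c ℓ c₁ ℓ₁ c₂ ℓ₂ ℓ′ ℓ″ : Level

_≐_ : {A : Set c} → Rel A ℓ′ → Rel A ℓ″ → Set _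
R ≐ S = (R ⇒ S) × (S ⇒ R)

IsLatticeHom : (L₁ : Lattice c₁ ℓ₁) (L₂ : Lattice c₂ ℓ₂) →
               (Lattice.Carrier L₁ → Lattice.Carrier L₂) → Set _
IsLatticeHom L₁ L₂ h =
  LatticeMorphisms.IsLatticeHomomorphism (Lattice.rawLattice L₁) (Lattice.rawLattice L₂) h

ker : {X : Set c} (L : Lattice c₂ ℓ₂) → (X → Lattice.Carrier L) → Rel X ℓ₂
ker L h x y = Lattice._≈_ L (h x) (h y)

module _ (L : Lattice c ℓ) where
  open Lattice L

  _≤L_ : Rel Carrier ℓ
  x ≤L y = (x ∧ y) ≈ x

  _<L_ : Rel Carrier ℓ
  x <L y = (x ≤L y) × ¬ (x ≈ y)

  data Gen (ps : List (Carrier × Carrier)) : Rel Carrier (c ⊔ ℓ) where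
    gen   : ∀ {x y} → (x , y) ∈ ps → Gen ps x y
    ≈⇒    : ∀ {x y} → x ≈ y → Gen ps x y
    symm  : ∀ {x y} → Gen ps x y → Gen ps y x
    trns  : ∀ {x y z} → Gen ps x y → Gen ps y z → Gen ps x z
    ∧-cng : ∀ {x y x′ y′} → Gen ps x y → Gen ps x′ y′ → Gen ps (x ∧ x′) (y ∧ y′)
    ∨-cng : ∀ {x y x′ y′} → Gen ps x y → Gen ps x′ y′ → Gen ps (x ∨ x′) (y ∨ y′)

  Θ : Carrier → Carrier → Rel Carrier (c ⊔ ℓ)
  Θ x y = Gen [ (x , y) ]

  -- compact (= finitely generated) congruences, presented by finite generating sets;
  -- two presentations denote the same element of Con_c L iff their Gen's are ≐.
  ConC : Set c
  ConC = List (Carrier × Carrier)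

  ⟦_⟧ : ConC → Rel Carrier (c ⊔ ℓ)
  ⟦ ps ⟧ = Gen ps

  -- order of Con_c L is inclusion; its least element is ⟦ [] ⟧, its greatest
  -- (if any) is one containing every compact congruence
  IsAtom : ConC → Set (c ⊔ ℓ)
  IsAtom ps = ¬ (⟦ ps ⟧ ⇒ ⟦ [] ⟧)
            × (∀ qs → ⟦ qs ⟧ ⇒ ⟦ ps ⟧ → (⟦ qs ⟧ ⇒ ⟦ [] ⟧) ⊎ (⟦ ps ⟧ ⇒ ⟦ qs ⟧))

  IsCoatom : ConC → Set (c ⊔ ℓ)
  IsCoatom ps = ¬ (∀ rs → ⟦ rs ⟧ ⇒ ⟦ ps ⟧)
              × (∀ qs → ⟦ ps ⟧ ⇒ ⟦ qs ⟧ → (⟦ qs ⟧ ⇒ ⟦ ps ⟧) ⊎ (∀ rs → ⟦ rs ⟧ ⇒ ⟦ qs ⟧))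

  _≤₂₂_ : Bool × Bool → Bool × Bool → Set
  (a , b) ≤₂₂ (a′ , b′) = (a Bool.≤ a′) × (b Bool.≤ b′)

  ConC≅2² : Set (c ⊔ ℓ)
  ConC≅2² = Σ (ConC → Bool × Bool) λ φ →
              (∀ t → ∃ λ ps → φ ps ≡ t)
            × (∀ ps qs → ((⟦ ps ⟧ ⇒ ⟦ qs ⟧) → φ ps ≤₂₂ φ qs)
                       × (φ ps ≤₂₂ φ qs → (⟦ ps ⟧ ⇒ ⟦ qs ⟧)))

  record CongruenceChain (a b : Carrier) : Set (c ⊔ ℓ) where
    field
      n      : ℕ
      x      : Fin (suc n) → Carrier
      incr   : ∀ (k : Fin n) → x (inject₁ k) <L x (suc k)
      first  : x zero ≈ a
      last   : x (fromℕ n) ≈ b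
      σ      : Fin n → ConC
      σ-atom : ∀ k → IsAtom (σ k)
      σ-inj  : ∀ i j → ⟦ σ i ⟧ ≐ ⟦ σ j ⟧ → i ≡ j
      σ-surj : ∀ ps → IsAtom ps → ∃ λ k → ⟦ ps ⟧ ≐ ⟦ σ k ⟧
      σ-Θ    : ∀ (k : Fin n) → Θ (x (inject₁ k)) (x (suc k)) ≐ ⟦ σ k ⟧

-- In 2² atoms and coatoms coincide, so ker π₀ and ker π₁ are the two atoms of Con_c B.
-- As they differ, some w has π₀ w ≉ π₁ w; swapping the projections if necessary,
-- u = π₀ w lies strictly below v = π₀ w ∨ π₁ w.  The element z = (w ∨ f u) ∧ f v has
-- π₀ z ≈ u and π₁ z ≈ v, so f u < z < f v with Θ(f u, z) ⊆ ker π₀ and Θ(z, f v) ⊆ ker π₁.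
-- Being nontrivial and below atoms, these two congruences are the two atoms.

module Submission where

open import Defs
open import Level using (Level; _⊔_)
open import Function using (_∘_)
open import Data.Bool using (Bool; true; false; b≤b; f≤t)
import Data.Bool.Properties as Bool
open import Data.Product using (Σ; ∃; _×_; _,_; proj₁; proj₂; uncurry)
open import Data.Sum using (_⊎_; inj₁; inj₂)
import Data.Sum as Sum
open import Data.Empty using (⊥-elim)
open import Data.Fin using (Fin; zero; suc)
open import Data.List using ([]; [_])
open import Data.List.Membership.Propositional using (_∈_; find)
open import Data.List.Relation.Unary.Any using (here)
import Data.List.Relation.Unary.All as All
open import Data.List.Relation.Unary.All.Properties using (¬All⇒Any¬)
open import Relation.Nullary using (¬_; Dec; yes; no)
open import Relation.Nullary.Decidable using (map′; _×-dec_)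
open import Relation.Binary.Core using (Rel; _⇒_)
open import Relation.Binary.Definitions using (Decidable)
open import Relation.Binary.PropositionalEquality using (_≡_; refl)
import Relation.Binary.Reasoning.Setoid as SetoidReasoning
open import Algebra.Lattice.Bundles using (Lattice)
open import Algebra.Lattice.Morphism.Structures using (module LatticeMorphisms)
import Algebra.Lattice.Properties.Lattice as LatticeProperties

private variable c ℓ c₁ ℓ₁ c₂ ℓ₂ ℓ′ ℓ″ : Level

≐-sym : {X : Set c} {R : Rel X ℓ′} {S : Rel X ℓ″} → R ≐ S → S ≐ R
≐-sym (R⇒S , S⇒R) = S⇒R , R⇒S

module Congruences (L : Lattice c ℓ) where
  open Lattice L hiding (reflexive) renaming (refl to ≈-refl)

  record IsCongruence (R : Rel Carrier ℓ′) : Set (c ⊔ ℓ ⊔ ℓ′) where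
    field
      reflexive : _≈_ ⇒ R
      symmetric : ∀ {x y} → R x y → R y x
      transitive : ∀ {x y z} → R x y → R y z → R x z
      ∧-compatible : ∀ {x y x′ y′} → R x y → R x′ y′ → R (x ∧ x′) (y ∧ y′)
      ∨-compatible : ∀ {x y x′ y′} → R x y → R x′ y′ → R (x ∨ x′) (y ∨ y′)

  ≈-isCongruence : IsCongruence _≈_
  ≈-isCongruence = record
    { reflexive = λ x≈y → x≈y ; symmetric = sym ; transitive = trans
    ; ∧-compatible = ∧-cong ; ∨-compatible = ∨-cong }

  Gen-isCongruence : ∀ ps → IsCongruence (Gen L ps)
  Gen-isCongruence ps = record
    { reflexive = ≈⇒ ; symmetric = symm ; transitive = trns
    ; ∧-compatible = ∧-cng ; ∨-compatible = ∨-cng }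

  Gen-least : {R : Rel Carrier ℓ′} → IsCongruence R →
              ∀ {ps} → (∀ {x y} → (x , y) ∈ ps → R x y) → Gen L ps ⇒ R
  Gen-least isR ps⊆R (gen xy∈ps) = ps⊆R xy∈ps
  Gen-least isR ps⊆R (≈⇒ x≈y) = IsCongruence.reflexive isR x≈y
  Gen-least isR ps⊆R (symm p) = IsCongruence.symmetric isR (Gen-least isR ps⊆R p)
  Gen-least isR ps⊆R (trns p q) =
    IsCongruence.transitive isR (Gen-least isR ps⊆R p) (Gen-least isR ps⊆R q)
  Gen-least isR ps⊆R (∧-cng p q) =
    IsCongruence.∧-compatible isR (Gen-least isR ps⊆R p) (Gen-least isR ps⊆R q)
  Gen-least isR ps⊆R (∨-cng p q) =
    IsCongruence.∨-compatible isR (Gen-least isR ps⊆R p) (Gen-least isR ps⊆R q)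

  Θ-least : {R : Rel Carrier ℓ′} → IsCongruence R → ∀ {a b} → R a b → Θ L a b ⇒ R
  Θ-least isR Rab = Gen-least isR λ { (here refl) → Rab }

  Gen[]⇒≈ : Gen L [] ⇒ _≈_
  Gen[]⇒≈ = Gen-least ≈-isCongruence λ ()

  Gen[]-least : ∀ qs → Gen L [] ⇒ Gen L qs
  Gen[]-least qs = Gen-least (Gen-isCongruence qs) λ ()

  generator-outside : {R : Rel Carrier ℓ′} → IsCongruence R → (∀ x y → Dec (R x y)) →
                      ∀ ps → ¬ (Gen L ps ⇒ R) → ∃ λ xy → xy ∈ ps × ¬ uncurry R xy
  generator-outside isR R? ps ps⊈R =
    find (¬All⇒Any¬ (uncurry R?) ps λ all → ps⊈R (Gen-least isR (All.lookup all)))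

  Θ⊆atom⇒≐ : ∀ {ps x y} → IsAtom L ps → Θ L x y ⇒ ⟦ L ⟧ ps → ¬ x ≈ y → Θ L x y ≐ ⟦ L ⟧ ps
  Θ⊆atom⇒≐ {x = x} {y} (_ , minimal) Θ⊆ps x≉y with minimal [ (x , y) ] Θ⊆ps
  ... | inj₁ Θ⊆[] = ⊥-elim (x≉y (Gen[]⇒≈ (Θ⊆[] (gen (here refl)))))
  ... | inj₂ ps⊆Θ = Θ⊆ps , ps⊆Θ

  coatom⊆coatom⇒≐ : ∀ {ps qs} → IsCoatom L ps → IsCoatom L qs →
                     (⟦ L ⟧ ps ⇒ ⟦ L ⟧ qs) → ⟦ L ⟧ ps ≐ ⟦ L ⟧ qs
  coatom⊆coatom⇒≐ {qs = qs} (_ , maximal) (qs-proper , _) ps⊆qs with maximal qs ps⊆qs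
  ... | inj₁ qs⊆ps = ps⊆qs , qs⊆ps
  ... | inj₂ qs-full = ⊥-elim (qs-proper qs-full)

  record AtomsExactly (k₀ k₁ : ConC L) : Set (c ⊔ ℓ) where
    field
      atom₀ : IsAtom L k₀
      atom₁ : IsAtom L k₁
      distinct : ¬ (⟦ L ⟧ k₀ ≐ ⟦ L ⟧ k₁)
      exhaustive : ∀ ps → IsAtom L ps → (⟦ L ⟧ ps ≐ ⟦ L ⟧ k₀) ⊎ (⟦ L ⟧ ps ≐ ⟦ L ⟧ k₁)

    swap : AtomsExactly k₁ k₀
    swap = record
      { atom₀ = atom₁ ; atom₁ = atom₀ ; distinct = distinct ∘ ≐-sym
      ; exhaustive = λ ps → Sum.swap ∘ exhaustive ps }

  twoStepChain : ∀ {x₀ x₁ x₂ k₀ k₁} → AtomsExactly k₀ k₁ →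
                 _<L_ L x₀ x₁ → _<L_ L x₁ x₂ →
                 Θ L x₀ x₁ ≐ ⟦ L ⟧ k₀ → Θ L x₁ x₂ ≐ ⟦ L ⟧ k₁ →
                 CongruenceChain L x₀ x₂
  twoStepChain {x₀} {x₁} {x₂} {k₀} {k₁} atoms x₀<x₁ x₁<x₂ Θ₀ Θ₁ = record
    { n = 2 ; x = x ; incr = λ where zero → x₀<x₁ ; (suc zero) → x₁<x₂
    ; first = ≈-refl ; last = ≈-refl ; σ = σ
    ; σ-atom = λ where zero → atom₀ ; (suc zero) → atom₁
    ; σ-inj = σ-inj
    ; σ-surj = σ-surj
    ; σ-Θ = λ where zero → Θ₀ ; (suc zero) → Θ₁ }
    where
    open AtomsExactly atoms
    x : Fin 3 → Carrier
    x zero = x₀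
    x (suc zero) = x₁
    x (suc (suc zero)) = x₂
    σ : Fin 2 → ConC L
    σ zero = k₀
    σ (suc zero) = k₁
    σ-inj : ∀ i j → ⟦ L ⟧ (σ i) ≐ ⟦ L ⟧ (σ j) → i ≡ j
    σ-inj zero zero _ = refl
    σ-inj zero (suc zero) k₀≐k₁ = ⊥-elim (distinct k₀≐k₁)
    σ-inj (suc zero) zero k₁≐k₀ = ⊥-elim (distinct (≐-sym k₁≐k₀))
    σ-inj (suc zero) (suc zero) _ = refl
    σ-surj : ∀ ps → IsAtom L ps → ∃ λ k → ⟦ L ⟧ ps ≐ ⟦ L ⟧ (σ k)
    σ-surj ps ps-atom with exhaustive ps ps-atom
    ... | inj₁ ps≐k₀ = zero , ps≐k₀
    ... | inj₂ ps≐k₁ = suc zero , ps≐k₁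

module JoinSeparates (L : Lattice c ℓ) where
  open Lattice L

  join-separates : Decidable _≈_ → ∀ {p q} → ¬ p ≈ q → ¬ p ≈ p ∨ q ⊎ ¬ q ≈ q ∨ p
  join-separates _≟_ {p} {q} p≉q with p ≟ (p ∨ q)
  ... | no p≉p∨q = inj₁ p≉p∨q
  ... | yes p≈p∨q = inj₂ λ q≈q∨p → p≉q (trans p≈p∨q (trans (∨-comm p q) (sym q≈q∨p)))

module TwoSquared (L : Lattice c ℓ) where
  open Lattice L using (_≈_)
  open Congruences L

  private
    _≤₂_ : Bool × Bool → Bool × Bool → Set
    _≤₂_ = _≤₂₂_ L

  ⊥₂ ⊤₂ : Bool × Bool
  ⊥₂ = false , false
  ⊤₂ = true , true

  ⊥₂-minimum : ∀ t → ⊥₂ ≤₂ t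
  ⊥₂-minimum (a , b) = Bool.≤-minimum a , Bool.≤-minimum b

  ⊤₂-maximum : ∀ t → t ≤₂ ⊤₂
  ⊤₂-maximum (a , b) = Bool.≤-maximum a , Bool.≤-maximum b

  ≤₂-trans : ∀ {s t u} → s ≤₂ t → t ≤₂ u → s ≤₂ u
  ≤₂-trans {_ , _} {_ , _} {_ , _} (a≤a′ , b≤b′) (a′≤a″ , b′≤b″) =
    Bool.≤-trans a≤a′ a′≤a″ , Bool.≤-trans b≤b′ b′≤b″

  _≤₂?_ : ∀ s t → Dec (s ≤₂ t)
  (a , b) ≤₂? (a′ , b′) = (a Bool.≤? a′) ×-dec (b Bool.≤? b′)

  Atom₂ : Bool × Bool → Set
  Atom₂ t = ¬ (t ≤₂ ⊥₂) × (∀ s → s ≤₂ t → s ≤₂ ⊥₂ ⊎ t ≤₂ s)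

  Coatom₂ : Bool × Bool → Set
  Coatom₂ t = ¬ (⊤₂ ≤₂ t) × (∀ s → t ≤₂ s → s ≤₂ t ⊎ ⊤₂ ≤₂ s)

  atom₂⇒coatom₂ : ∀ t → Atom₂ t → Coatom₂ t
  atom₂⇒coatom₂ (false , false) (nontrivial , _) = ⊥-elim (nontrivial (b≤b , b≤b))
  atom₂⇒coatom₂ (true , true) (_ , minimal) with minimal (true , false) (b≤b , f≤t)
  ... | inj₁ (() , _)
  ... | inj₂ (_ , ())
  atom₂⇒coatom₂ (true , false) _ = (λ { (_ , ()) }) , λ where
    (true , false) _ → inj₁ (b≤b , b≤b)
    (true , true) _ → inj₂ (b≤b , b≤b)
    (false , _) (() , _)
  atom₂⇒coatom₂ (false , true) _ = (λ { (() , _) }) , λ where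
    (false , true) _ → inj₁ (b≤b , b≤b)
    (true , true) _ → inj₂ (b≤b , b≤b)
    (_ , false) (_ , ())

  coatom₂⇒atom₂ : ∀ t → Coatom₂ t → Atom₂ t
  coatom₂⇒atom₂ (true , true) (proper , _) = ⊥-elim (proper (b≤b , b≤b))
  coatom₂⇒atom₂ (false , false) (_ , maximal) with maximal (true , false) (f≤t , b≤b)
  ... | inj₁ (() , _)
  ... | inj₂ (_ , ())
  coatom₂⇒atom₂ (true , false) _ = (λ { (() , _) }) , λ where
    (false , false) _ → inj₁ (b≤b , b≤b)
    (true , false) _ → inj₂ (b≤b , b≤b)
    (_ , true) (_ , ())
  coatom₂⇒atom₂ (false , true) _ = (λ { (_ , ()) }) , λ where
    (false , false) _ → inj₁ (b≤b , b≤b)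
    (false , true) _ → inj₂ (b≤b , b≤b)
    (true , _) (() , _)

  module _ (iso : ConC≅2² L) where
    φ : ConC L → Bool × Bool
    φ = proj₁ iso

    ⊆⇒≤ : ∀ ps qs → ⟦ L ⟧ ps ⇒ ⟦ L ⟧ qs → φ ps ≤₂ φ qs
    ⊆⇒≤ ps qs = proj₁ (proj₂ (proj₂ iso) ps qs)

    ≤⇒⊆ : ∀ ps qs → φ ps ≤₂ φ qs → ⟦ L ⟧ ps ⇒ ⟦ L ⟧ qs
    ≤⇒⊆ ps qs = proj₂ (proj₂ (proj₂ iso) ps qs)

    ∀-image : {P : Bool × Bool → Set ℓ′} → (∀ ps → P (φ ps)) → ∀ t → P t
    ∀-image P-φ t with proj₁ (proj₂ iso) t
    ... | ps , refl = P-φ ps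

    φ[]-minimum : ∀ t → φ [] ≤₂ t
    φ[]-minimum = ∀-image {P = φ [] ≤₂_} λ qs → ⊆⇒≤ [] qs (Gen[]-least qs)

    ⊆[]⇒≤⊥₂ : ∀ ps → ⟦ L ⟧ ps ⇒ ⟦ L ⟧ [] → φ ps ≤₂ ⊥₂
    ⊆[]⇒≤⊥₂ ps ps⊆[] = ≤₂-trans (⊆⇒≤ ps [] ps⊆[]) (φ[]-minimum ⊥₂)

    ≤⊥₂⇒⊆[] : ∀ ps → φ ps ≤₂ ⊥₂ → ⟦ L ⟧ ps ⇒ ⟦ L ⟧ []
    ≤⊥₂⇒⊆[] ps ps≤⊥₂ = ≤⇒⊆ ps [] (≤₂-trans ps≤⊥₂ (⊥₂-minimum (φ [])))

    full⇒⊤₂≤ : ∀ ps → (∀ rs → ⟦ L ⟧ rs ⇒ ⟦ L ⟧ ps) → ⊤₂ ≤₂ φ ps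
    full⇒⊤₂≤ ps full = ∀-image {P = _≤₂ φ ps} (λ rs → ⊆⇒≤ rs ps (full rs)) ⊤₂

    ⊤₂≤⇒full : ∀ ps → ⊤₂ ≤₂ φ ps → ∀ rs → ⟦ L ⟧ rs ⇒ ⟦ L ⟧ ps
    ⊤₂≤⇒full ps ⊤₂≤ps rs = ≤⇒⊆ rs ps (≤₂-trans (⊤₂-maximum (φ rs)) ⊤₂≤ps)

    isAtom⇒atom₂ : ∀ ps → IsAtom L ps → Atom₂ (φ ps)
    isAtom⇒atom₂ ps (nontrivial , minimal) =
      (λ ps≤⊥₂ → nontrivial (≤⊥₂⇒⊆[] ps ps≤⊥₂)) ,
      ∀-image {P = λ s → s ≤₂ φ ps → s ≤₂ ⊥₂ ⊎ φ ps ≤₂ s} λ qs qs≤ps →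
        Sum.map (⊆[]⇒≤⊥₂ qs) (⊆⇒≤ ps qs) (minimal qs (≤⇒⊆ qs ps qs≤ps))

    atom₂⇒isAtom : ∀ ps → Atom₂ (φ ps) → IsAtom L ps
    atom₂⇒isAtom ps (nontrivial , minimal) =
      (λ ps⊆[] → nontrivial (⊆[]⇒≤⊥₂ ps ps⊆[])) , λ qs qs⊆ps →
        Sum.map (≤⊥₂⇒⊆[] qs) (≤⇒⊆ ps qs) (minimal (φ qs) (⊆⇒≤ qs ps qs⊆ps))

    isCoatom⇒coatom₂ : ∀ ps → IsCoatom L ps → Coatom₂ (φ ps)
    isCoatom⇒coatom₂ ps (proper , maximal) =
      (λ ⊤₂≤ps → proper (⊤₂≤⇒full ps ⊤₂≤ps)) ,
      ∀-image {P = λ s → φ ps ≤₂ s → s ≤₂ φ ps ⊎ ⊤₂ ≤₂ s} λ qs ps≤qs →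
        Sum.map (⊆⇒≤ qs ps) (full⇒⊤₂≤ qs) (maximal qs (≤⇒⊆ ps qs ps≤qs))

    coatom₂⇒isCoatom : ∀ ps → Coatom₂ (φ ps) → IsCoatom L ps
    coatom₂⇒isCoatom ps (proper , maximal) =
      (λ ps-full → proper (full⇒⊤₂≤ ps ps-full)) , λ qs ps⊆qs →
        Sum.map (≤⇒⊆ qs ps) (⊤₂≤⇒full qs) (maximal (φ qs) (⊆⇒≤ ps qs ps⊆qs))

    isAtom⇒isCoatom : ∀ ps → IsAtom L ps → IsCoatom L ps
    isAtom⇒isCoatom ps = coatom₂⇒isCoatom ps ∘ atom₂⇒coatom₂ (φ ps) ∘ isAtom⇒atom₂ ps

    isCoatom⇒isAtom : ∀ ps → IsCoatom L ps → IsAtom L ps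
    isCoatom⇒isAtom ps = atom₂⇒isAtom ps ∘ coatom₂⇒atom₂ (φ ps) ∘ isCoatom⇒coatom₂ ps

    -- x ≈ y iff Θ(x, y) is the bottom of the finite Con_c L; this is what makes the
    -- choice of a separating element and of an orientation constructive.
    ≈-dec : Decidable _≈_
    ≈-dec x y = map′
      (λ Θ≤⊥₂ → Gen[]⇒≈ (≤⊥₂⇒⊆[] [ (x , y) ] Θ≤⊥₂ (gen (here refl))))
      (λ x≈y → ⊆[]⇒≤⊥₂ [ (x , y) ] (Θ-least (Gen-isCongruence []) (≈⇒ x≈y)))
      (φ [ (x , y) ] ≤₂? ⊥₂)

module Homomorphisms (A : Lattice c₁ ℓ₁) (B : Lattice c₂ ℓ₂) where
  private
    module A = Lattice A
    module B = Lattice B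
  open LatticeMorphisms.IsLatticeHomomorphism
  open Congruences B

  ker-isCongruence : ∀ {π} → IsLatticeHom B A π → IsCongruence (ker A π)
  ker-isCongruence hπ = record
    { reflexive = ⟦⟧-cong hπ ; symmetric = A.sym ; transitive = A.trans
    ; ∧-compatible = λ p q →
        A.trans (∧-homo hπ _ _) (A.trans (A.∧-cong p q) (A.sym (∧-homo hπ _ _)))
    ; ∨-compatible = λ p q →
        A.trans (∨-homo hπ _ _) (A.trans (A.∨-cong p q) (A.sym (∨-homo hπ _ _))) }

  retract-≈-dec : ∀ {f π} → IsLatticeHom A B f → IsLatticeHom B A π →
                  (∀ x → π (f x) A.≈ x) → Decidable B._≈_ → Decidable A._≈_
  retract-≈-dec {f} {π} hf hπ π∘f _≟_ u v = map′
    (λ fu≈fv → A.trans (A.sym (π∘f u)) (A.trans (⟦⟧-cong hπ fu≈fv) (π∘f v)))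
    (⟦⟧-cong hf)
    (f u ≟ f v)

  separating-element : ∀ {π₀ π₁} → IsLatticeHom B A π₁ → Decidable A._≈_ →
                       ∀ ps → Gen B ps ⇒ ker A π₀ → ¬ (Gen B ps ⇒ ker A π₁) →
                       ∃ λ w → ¬ π₀ w A.≈ π₁ w
  separating-element {π₀} {π₁} hπ₁ _≟_ ps ps⊆ker₀ ps⊈ker₁
    with generator-outside (ker-isCongruence hπ₁) (λ x y → π₁ x ≟ π₁ y) ps ps⊈ker₁
  ... | (x , y) , xy∈ps , π₁x≉π₁y with π₀ x ≟ π₁ x
  ...   | no π₀x≉π₁x = x , π₀x≉π₁x
  ...   | yes π₀x≈π₁x = y , λ π₀y≈π₁y →
          π₁x≉π₁y (A.trans (A.sym π₀x≈π₁x) (A.trans (ps⊆ker₀ (gen xy∈ps)) π₀y≈π₁y))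

ChainBetweenImages : (A : Lattice c₁ ℓ₁) (B : Lattice c₂ ℓ₂) →
                     (Lattice.Carrier A → Lattice.Carrier B) → Set (c₁ ⊔ ℓ₁ ⊔ c₂ ⊔ ℓ₂)
ChainBetweenImages A B f =
  Σ (Lattice.Carrier A) λ u → Σ (Lattice.Carrier A) λ v →
    _<L_ A u v × CongruenceChain B (f u) (f v)

module KernelChain
    {a ℓa b ℓb : Level} (A : Lattice a ℓa) (B : Lattice b ℓb)
    {f : Lattice.Carrier A → Lattice.Carrier B}
    {π₀ π₁ : Lattice.Carrier B → Lattice.Carrier A}
    (hf : IsLatticeHom A B f) (h₀ : IsLatticeHom B A π₀) (h₁ : IsLatticeHom B A π₁)
    (π₀∘f : ∀ x → Lattice._≈_ A (π₀ (f x)) x)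
    (π₁∘f : ∀ x → Lattice._≈_ A (π₁ (f x)) x)
    {k₀ k₁ : ConC B} (ker₀⊆k₀ : ker A π₀ ⇒ ⟦ B ⟧ k₀) (ker₁⊆k₁ : ker A π₁ ⇒ ⟦ B ⟧ k₁)
    (atoms : Congruences.AtomsExactly B k₀ k₁) where
  private
    module A = Lattice A
    module B = Lattice B
    module F = LatticeMorphisms.IsLatticeHomomorphism hf
    module H₀ = LatticeMorphisms.IsLatticeHomomorphism h₀
    module H₁ = LatticeMorphisms.IsLatticeHomomorphism h₁
  open Congruences B
  open Homomorphisms A B using (ker-isCongruence)
  open AtomsExactly atoms using (atom₀; atom₁)
  open A using (_≈_; _∧_; _∨_)
  open B using () renaming (_≈_ to _≈ᴮ_; _∧_ to _∧ᴮ_; _∨_ to _∨ᴮ_)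

  image-of-meet-join : ∀ {π} → IsLatticeHom B A π → (∀ x → π (f x) ≈ x) →
                       ∀ w u v → π ((w ∨ᴮ f u) ∧ᴮ f v) ≈ (π w ∨ u) ∧ v
  image-of-meet-join {π} hπ π∘f w u v = begin
    π ((w ∨ᴮ f u) ∧ᴮ f v)         ≈⟨ ∧-homo _ _ ⟩
    π (w ∨ᴮ f u) ∧ π (f v)        ≈⟨ A.∧-cong (∨-homo _ _) (π∘f v) ⟩
    (π w ∨ π (f u)) ∧ v           ≈⟨ A.∧-cong (A.∨-cong A.refl (π∘f u)) A.refl ⟩
    (π w ∨ u) ∧ v                 ∎
    where
    open SetoidReasoning A.setoid
    open LatticeMorphisms.IsLatticeHomomorphism hπ

  chain : ∀ w → ¬ π₀ w ≈ π₀ w ∨ π₁ w → ChainBetweenImages A B f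
  chain w u≉v = u , v , (A.∧-absorbs-∨ u (π₁ w) , u≉v) ,
    twoStepChain atoms (fu≤z , fu≉z) (z≤fv , z≉fv) Θ[fu,z]≐k₀ Θ[z,fv]≐k₁
    where
    u v : A.Carrier
    u = π₀ w
    v = u ∨ π₁ w

    z : B.Carrier
    z = (w ∨ᴮ f u) ∧ᴮ f v

    π₀z≈u : π₀ z ≈ u
    π₀z≈u = A.trans (image-of-meet-join h₀ π₀∘f w u v)
      (A.trans (A.∧-cong (LatticeProperties.∨-idem A u) A.refl) (A.∧-absorbs-∨ u (π₁ w)))

    π₁z≈v : π₁ z ≈ v
    π₁z≈v = A.trans (image-of-meet-join h₁ π₁∘f w u v)
      (A.trans (A.∧-cong (A.∨-comm (π₁ w) u) A.refl) (LatticeProperties.∧-idem A v))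

    fu≤z : _≤L_ B (f u) z
    fu≤z = begin
      f u ∧ᴮ z                        ≈⟨ B.sym (B.∧-assoc _ _ _) ⟩
      (f u ∧ᴮ (w ∨ᴮ f u)) ∧ᴮ f v      ≈⟨ B.∧-cong (B.∧-cong B.refl (B.∨-comm _ _)) B.refl ⟩
      (f u ∧ᴮ (f u ∨ᴮ w)) ∧ᴮ f v      ≈⟨ B.∧-cong (B.∧-absorbs-∨ _ _) B.refl ⟩
      f u ∧ᴮ f v                      ≈⟨ B.sym (F.∧-homo _ _) ⟩
      f (u ∧ v)                       ≈⟨ F.⟦⟧-cong (A.∧-absorbs-∨ u (π₁ w)) ⟩
      f u                             ∎
      where open SetoidReasoning B.setoid

    z≤fv : _≤L_ B z (f v)
    z≤fv = B.trans (B.∧-assoc _ _ _) (B.∧-cong B.refl (LatticeProperties.∧-idem B (f v)))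

    fu≉z : ¬ f u ≈ᴮ z
    fu≉z fu≈z = u≉v (A.trans (A.sym (π₁∘f u)) (A.trans (H₁.⟦⟧-cong fu≈z) π₁z≈v))

    z≉fv : ¬ z ≈ᴮ f v
    z≉fv z≈fv = u≉v (A.trans (A.sym π₀z≈u) (A.trans (H₀.⟦⟧-cong z≈fv) (π₀∘f v)))

    Θ[fu,z]≐k₀ : Θ B (f u) z ≐ ⟦ B ⟧ k₀
    Θ[fu,z]≐k₀ = Θ⊆atom⇒≐ atom₀
      (ker₀⊆k₀ ∘ Θ-least (ker-isCongruence h₀) (A.trans (π₀∘f u) (A.sym π₀z≈u))) fu≉z

    Θ[z,fv]≐k₁ : Θ B z (f v) ≐ ⟦ B ⟧ k₁
    Θ[z,fv]≐k₁ = Θ⊆atom⇒≐ atom₁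
      (ker₁⊆k₁ ∘ Θ-least (ker-isCongruence h₁) (A.trans π₁z≈v (A.sym (π₁∘f v)))) z≉fv

lemma5p1 : ∀ {a ℓa b ℓb : Level} (A : Lattice a ℓa) (B : Lattice b ℓb)
  (f : Lattice.Carrier A → Lattice.Carrier B)
  (π₀ π₁ : Lattice.Carrier B → Lattice.Carrier A) →
  IsLatticeHom A B f → IsLatticeHom B A π₀ → IsLatticeHom B A π₁ →
  (∀ x → Lattice._≈_ A (π₀ (f x)) x) →
  (∀ x → Lattice._≈_ A (π₁ (f x)) x) →
  ConC≅2² B →
  (Σ (ConC B) λ k₀ → Σ (ConC B) λ k₁ →
      (⟦ B ⟧ k₀ ≐ ker A π₀) × (⟦ B ⟧ k₁ ≐ ker A π₁)
    × IsCoatom B k₀ × IsCoatom B k₁ × ¬ (⟦ B ⟧ k₀ ≐ ⟦ B ⟧ k₁)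
    × (∀ ks → IsCoatom B ks → (⟦ B ⟧ ks ≐ ⟦ B ⟧ k₀) ⊎ (⟦ B ⟧ ks ≐ ⟦ B ⟧ k₁))) →
  Σ (Lattice.Carrier A) λ u → Σ (Lattice.Carrier A) λ v →
    _<L_ A u v × CongruenceChain B (f u) (f v)
lemma5p1 A B f π₀ π₁ hf h₀ h₁ π₀∘f π₁∘f iso
         (k₀ , k₁ , k₀≐ker₀ , k₁≐ker₁ , co₀ , co₁ , k₀≉k₁ , coatoms) =
  chainFrom (separating-element h₁ _≟_ k₀ (proj₁ k₀≐ker₀) k₀⊈ker₁)
  where
  open TwoSquared B using (≈-dec; isCoatom⇒isAtom; isAtom⇒isCoatom)
  open Congruences B using (AtomsExactly; coatom⊆coatom⇒≐)
  open Homomorphisms A B using (separating-element; retract-≈-dec)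
  open JoinSeparates A using (join-separates)

  _≟_ : Decidable (Lattice._≈_ A)
  _≟_ = retract-≈-dec hf h₀ π₀∘f (≈-dec iso)

  k₀⊈ker₁ : ¬ (⟦ B ⟧ k₀ ⇒ ker A π₁)
  k₀⊈ker₁ k₀⊆ker₁ = k₀≉k₁ (coatom⊆coatom⇒≐ co₀ co₁ (proj₂ k₁≐ker₁ ∘ k₀⊆ker₁))

  atoms : AtomsExactly k₀ k₁
  atoms = record
    { atom₀ = isCoatom⇒isAtom iso k₀ co₀ ; atom₁ = isCoatom⇒isAtom iso k₁ co₁
    ; distinct = k₀≉k₁ ; exhaustive = λ ps → coatoms ps ∘ isAtom⇒isCoatom iso ps }

  module Chain₀₁ = KernelChain A B hf h₀ h₁ π₀∘f π₁∘f (proj₂ k₀≐ker₀) (proj₂ k₁≐ker₁) atoms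
  module Chain₁₀ = KernelChain A B hf h₁ h₀ π₁∘f π₀∘f (proj₂ k₁≐ker₁) (proj₂ k₀≐ker₀)
                     (AtomsExactly.swap atoms)

  chainFrom : (∃ λ w → ¬ Lattice._≈_ A (π₀ w) (π₁ w)) → ChainBetweenImages A B f
  chainFrom (w , π₀w≉π₁w) =
    Sum.[ Chain₀₁.chain w , Chain₁₀.chain w ] (join-separates _≟_ π₀w≉π₁w)
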